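{- Let $X$ be a finite set with $|X|\ge3$, $\mathfrak{C}$ the set of partial choice functions on pairs from $X$, and $\mathscr{C}\subseteq\mathfrak{C}$ symmetric. If some $c\in\mathscr{C}$ is valence-imbalanced, then for every 2-element set $\{x,y\}\subseteq X$ there is $d\in\operatorname{maj}^{\mathrm{cl}}(\mathscr{C})$ with $\operatorname{dom}d=\{\{x,y\}\}$.
   Context: $\mathfrak{C}$ is the set of all functions $c\colon Y\to X$ with $Y\subseteq\binom{X}{2}$ and $c\{x,y\}\in\{x,y\}$. $W^x_y(c)$ is $1$ if $c\{x,y\}=x$, $-1$ if $c\{x,y\}=y$, $0$ if $\{x,y\}\notin\operatorname{dom}c$ (including $x=y$). $\mathscr{C}$ is symmetric if closed under $c\mapsto c^\sigma$ for permutations $\sigma$ of $X$, where $c^\sigma\{\sigma(x),\sigma(y)\}=\sigma(x)$ iff $c\{x,y\}=x$. $\operatorname{maj}^{\mathrm{cl}}(\mathscr{C})$ is the set of $d\in\mathfrak{C}$ for which there are rationals $r_c\in[0,1]$ with $\sum_c r_c=1$ and $d\{u,v\}=u\iff\sum_c W^u_v(c)r_c>0$. $\operatorname{val}_c(x)=\sum_{y}W^x_y(c)$; $V_\ell(c)=\{(\operatorname{val}_c(u)-\ell,\operatorname{val}_c(v)+\ell):u\ne v,\ W^u_v(c)=\ell\}$ for $\ell\in\{ -1,0,1\}$; $\operatorname{conv}$ is convex hull in $\mathbb{Q}\times\mathbb{Q}$. $c$ is valence-imbalanced if $(0,0)=r_{ -1}\bar v_{ -1}+r_0\bar v_0+r_1\bar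 v_1$ with $\bar v_\ell\in\operatorname{conv}(V_\ell(c))$, $r_\ell\in[0,1]\cap\mathbb{Q}$, $r_{ -1}+r_0+r_1=1$, $r_{ -1}\neq r_1$, where terms with coefficient $0$ may be omitted. -}

module Defs where

open import Data.Nat using (ℕ)
open import Data.Fin using (Fin; _≟_)
open import Data.Fin.Permutation using (Permutation′; _⟨$⟩ʳ_; _⟨$⟩ˡ_)
open import Data.Integer using (ℤ; +_; -_)
import Data.Integer as ℤ
open import Data.Rational using (ℚ; _+_; _*_; 0ℚ; 1ℚ; _≤_; _<_; _/_)
open import Data.Maybe using (Maybe; just; nothing)
import Data.Maybe as Maybe
open import Data.List using (List; []; _∷_; map; foldr; concatMap; length; lookup)
open import Data.List using (allFin) renaming (filter to lfilter)
open import Data.Product using (_×_; _,_; Σ; proj₁; proj₂)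
open import Data.Sum using (_⊎_)
open import Relation.Binary.PropositionalEquality using (_≡_; _≢_)
open import Relation.Nullary using (¬_; ¬?; _×-dec_; yes; no; Dec)
open import Function.Bundles using (_⇔_)

-- The ground set X is Fin n.
-- A (raw) partial choice function on pairs: c x y = c{x,y} if {x,y} ∈ dom c,
-- nothing otherwise.
RawChoice : ℕ → Set
RawChoice n = Fin n → Fin n → Maybe (Fin n)

record IsChoiceFn {n : ℕ} (c : RawChoice n) : Set where
  field
    unordered : ∀ x y → c x y ≡ c y x
    noDiag    : ∀ x → c x x ≡ nothing
    chooses   : ∀ x y z → c x y ≡ just z → (z ≡ x) ⊎ (z ≡ y)

W : {n : ℕ} → RawChoice n → Fin n → Fin n → ℤ
W c x y with c x y
... | nothing = + 0
... | just z with z ≟ x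
...   | yes _ = + 1
...   | no _  = - (+ 1)

-- c^σ : c^σ{σx,σy} = σ(c{x,y})
permute : {n : ℕ} → Permutation′ n → RawChoice n → RawChoice n
permute σ c a b = Maybe.map (σ ⟨$⟩ʳ_) (c (σ ⟨$⟩ˡ a) (σ ⟨$⟩ˡ b))

Symmetric : {n : ℕ} → (RawChoice n → Set) → Set
Symmetric {n} 𝒞 = ∀ (σ : Permutation′ n) c → 𝒞 c → 𝒞 (permute σ c)

sumℚ : List ℚ → ℚ
sumℚ = foldr _+_ 0ℚ

sumℤ : List ℤ → ℤ
sumℤ = foldr ℤ._+_ (+ 0)

toℚ : ℤ → ℚ
toℚ z = z / 1

-- maj^cl(𝒞): a finitely supported rational weighting r of 𝒞 (given as a list
-- of pairs (c , r_c), c ∈ 𝒞, r_c ∈ [0,1], Σ r_c = 1) such that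
-- d{u,v} = u  ⇔  Σ_c W^u_v(c) r_c > 0.
weightedW : {n : ℕ} → List (RawChoice n × ℚ) → Fin n → Fin n → ℚ
weightedW L u v = sumℚ (map (λ p → toℚ (W (proj₁ p) u v) * proj₂ p) L)

data All {A : Set} (P : A → Set) : List A → Set where
  []  : All P []
  _∷_ : ∀ {x xs} → P x → All P xs → All P (x ∷ xs)

InMajCl : {n : ℕ} → (RawChoice n → Set) → RawChoice n → Set
InMajCl {n} 𝒞 d =
  IsChoiceFn d ×
  Σ (List (RawChoice n × ℚ)) λ L →
    All (λ p → 𝒞 (proj₁ p) × (0ℚ ≤ proj₂ p) × (proj₂ p ≤ 1ℚ)) L ×
    sumℚ (map proj₂ L) ≡ 1ℚ ×
    (∀ u v → (d u v ≡ just u) ⇔ (0ℚ < weightedW L u v))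

DomIsPair : {n : ℕ} → RawChoice n → Fin n → Fin n → Set
DomIsPair d x y =
  ∀ u v → (d u v ≢ nothing) ⇔ ((u ≡ x × v ≡ y) ⊎ (u ≡ y × v ≡ x))

val : {n : ℕ} → RawChoice n → Fin n → ℤ
val {n} c x = sumℤ (map (W c x) (allFin n))

allPairs : (n : ℕ) → List (Fin n × Fin n)
allPairs n = concatMap (λ u → map (λ v → (u , v)) (allFin n)) (allFin n)

Point : Set
Point = ℚ × ℚ

_+ᵖ_ : Point → Point → Point
(a , b) +ᵖ (c , d) = (a + c , b + d)

_·ᵖ_ : ℚ → Point → Point
r ·ᵖ (a , b) = (r * a , r * b)

0ᵖ : Point
0ᵖ = (0ℚ , 0ℚ)

V : {n : ℕ} → ℤ → RawChoice n → List Point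
V {n} ℓ c = map (λ p → toℚ (val c (proj₁ p) ℤ.- ℓ) , toℚ (val c (proj₂ p) ℤ.+ ℓ))
                (lfilter (λ p → sel p) (allPairs n))
  where
  sel : (p : Fin n × Fin n) → Dec ((¬ (proj₁ p ≡ proj₂ p)) × (W c (proj₁ p) (proj₂ p) ≡ ℓ))
  sel (u , v) = (¬? (u ≟ v)) ×-dec (W c u v ℤ.≟ ℓ)

InConv : List Point → Point → Set
InConv S p = Σ (Fin (length S) → ℚ) λ w →
  (∀ i → 0ℚ ≤ w i) ×
  sumℚ (map w (allFin (length S))) ≡ 1ℚ ×
  p ≡ foldr _+ᵖ_ 0ᵖ (map (λ i → w i ·ᵖ lookup S i) (allFin (length S)))

InUnit : ℚ → Set
InUnit r = (0ℚ ≤ r) × (r ≤ 1ℚ)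

-- valence-imbalanced (a term with coefficient 0 may be omitted, i.e. its
-- point need not lie in the hull)
ValenceImbalanced : {n : ℕ} → RawChoice n → Set
ValenceImbalanced c =
  Σ ℚ λ rm → Σ ℚ λ r0 → Σ ℚ λ rp →
  Σ Point λ vm → Σ Point λ v0 → Σ Point λ vp →
    InUnit rm × InUnit r0 × InUnit rp ×
    rm + r0 + rp ≡ 1ℚ × rm ≢ rp ×
    (rm ≡ 0ℚ ⊎ InConv (V (- (+ 1)) c) vm) ×
    (r0 ≡ 0ℚ ⊎ InConv (V (+ 0) c) v0) ×
    (rp ≡ 0ℚ ⊎ InConv (V (+ 1) c) vp) ×
    0ᵖ ≡ (rm ·ᵖ vm) +ᵖ ((r0 ·ᵖ v0) +ᵖ (rp ·ᵖ vp))

module Submission where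

-- First the
-- imbalance is unfolded into a certificate: ordered pairs (a , b), a ≠ b,
-- with weights ρ ≥ 0 summing to 1, such that the weighted sums of
-- val(a) − W^a_b and of val(b) + W^a_b vanish while that of W^a_b is
-- positive (reversing all pairs if the match total r₁ − r₋₁ is negative).
-- Given x ≠ y, each certificate pair contributes the 2m relabellings of c
-- sending a ↦ x, b ↦ y and acting on the other m points by the dihedral
-- group of ℤ/m, each with weight ρ/2m.  The dihedral average keeps the
-- match of x and y, spreads the rows of x and y evenly over the other
-- points (so their margins are the vanishing sums above), and cancels
-- every pair of other points.  So the margin is positive at (x , y) and
-- zero off {x , y}, which puts the choice function with domain {{x , y}}
-- into maj^cl(𝒞).

open import Defs
open import Data.Nat as ℕ using (ℕ; zero; suc; _%_; s≤s)
open import Data.Nat.DivMod using (_mod_; %-distribˡ-+; m%n%n≡m%n; n%n≡0; m<n⇒m%n≡m; m%n<n)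
import Data.Nat.Properties as ℕP
open import Data.Fin using (Fin; zero; suc; toℕ; _≟_)
open import Data.Fin.Properties using (toℕ-injective; toℕ-fromℕ<; toℕ<n)
open import Data.Fin.Permutation
  using (Permutation′; permutation; transpose; flip; lift₀; _∘ₚ_; _⟨$⟩ʳ_; _⟨$⟩ˡ_; inverseˡ; inverseʳ)
import Data.Fin.Permutation.Components as PC
open import Data.Integer as ℤ using (ℤ; +_; -_)
import Data.Integer.Properties as ℤP
open import Data.Integer.Solver using (module +-*-Solver)
open import Algebra.Properties.CommutativeMonoid.Sum ℤP.+-0-commutativeMonoid
  using (sum; sum-cong-≗; sum-permute)
open import Data.Rational as ℚ using (ℚ; _+_; _*_; _≤_; _<_; 0ℚ; 1ℚ; _/_)
import Data.Rational.Properties as ℚP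
open import Data.Rational.Unnormalised as ℚᵘ using (mkℚᵘ; *≡*) renaming (_≃_ to _≃ᵘ_)
import Data.Rational.Unnormalised.Properties as ℚᵘP
import Data.Rational.Solver as ℚSolver
open import Data.Maybe using (Maybe; just; nothing)
import Data.Maybe as Maybe
open import Data.List using (List; []; _∷_; _++_; map; concatMap; foldr; allFin; tabulate; length; lookup)
open import Data.List.Membership.Propositional using (_∈_)
open import Data.List.Membership.Propositional.Properties using (∈-lookup; ∈-map⁻; ∈-filter⁻)
import Data.List.Properties as ListP
import Data.List.Relation.Unary.All as ListAll
open ListAll using ([]; _∷_)
import Data.List.Relation.Unary.All.Properties as ListAllP
open import Data.Product using (Σ; _×_; _,_; proj₁; proj₂)
open import Data.Sum using (_⊎_; inj₁; inj₂)
open import Data.Empty using (⊥-elim)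
open import Function using (_∘_)
open import Relation.Nullary using (Dec; yes; no; ¬_; ¬?; _×-dec_; _⊎-dec_)
open import Function.Bundles using (_⇔_; mk⇔)
open import Relation.Binary.PropositionalEquality
open import Relation.Binary.Definitions using (Tri; tri<; tri≈; tri>)

-- Choice functions as antisymmetric integer matrices

Antisymmetric : ∀ {n} → (Fin n → Fin n → ℤ) → Set
Antisymmetric F = ∀ p q → F p q ≡ - F q p

antisym-diag : ∀ {n} {F : Fin n → Fin n → ℤ} → Antisymmetric F → ∀ p → F p p ≡ + 0
antisym-diag {F = F} anti p = self-neg (F p p) (anti p p)
  where
  self-neg : ∀ z → z ≡ - z → z ≡ + 0
  self-neg (+ zero)     _  = refl
  self-neg (+ suc _)    ()
  self-neg (ℤ.-[1+ _ ]) ()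

score : ∀ {n} → Maybe (Fin n) → Fin n → ℤ
score nothing  x = + 0
score (just z) x with z ≟ x
... | yes _ = + 1
... | no _  = - (+ 1)

W≡score : ∀ {n} (c : RawChoice n) x y → W c x y ≡ score (c x y) x
W≡score c x y with c x y
... | nothing = refl
... | just z with z ≟ x
...   | yes _ = refl
...   | no _  = refl

score-winner : ∀ {n} (z : Fin n) → score (just z) z ≡ + 1
score-winner z with z ≟ z
... | yes _  = refl
... | no z≢z = ⊥-elim (z≢z refl)

score-loser : ∀ {n} (z x : Fin n) → z ≢ x → score (just z) x ≡ - (+ 1)
score-loser z x z≢x with z ≟ x
... | yes z≡x = ⊥-elim (z≢x z≡x)
... | no _    = refl

W-antisym : ∀ {n} {c : RawChoice n} → IsChoiceFn c → Antisymmetric (W c)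
W-antisym {c = c} isC p q = begin
  W c p q             ≡⟨ W≡score c p q ⟩
  score (c p q) p     ≡⟨ opposite-scores (c p q) refl ⟩
  - score (c p q) q   ≡⟨ cong (λ o → - score o q) (IsChoiceFn.unordered isC p q) ⟩
  - score (c q p) q   ≡⟨ cong -_ (sym (W≡score c q p)) ⟩
  - W c q p           ∎
  where
  open ≡-Reasoning
  opposite-scores : ∀ o → c p q ≡ o → score o p ≡ - score o q
  opposite-scores nothing _ = refl
  opposite-scores (just z) cpq≡z with p ≟ q
  opposite-scores (just z) cpq≡z | yes refl with trans (sym cpq≡z) (IsChoiceFn.noDiag isC p)
  ... | ()
  opposite-scores (just z) cpq≡z | no p≢q with IsChoiceFn.chooses isC p q z cpq≡z
  ... | inj₁ refl = trans (score-winner z) (cong -_ (sym (score-loser z q p≢q)))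
  ... | inj₂ refl = trans (score-loser z p (p≢q ∘ sym)) (cong -_ (sym (score-winner z)))

W-permute : ∀ {n} (σ : Permutation′ n) c u v →
            W (permute σ c) u v ≡ W c (σ ⟨$⟩ˡ u) (σ ⟨$⟩ˡ v)
W-permute σ c u v = begin
  W (permute σ c) u v                            ≡⟨ W≡score (permute σ c) u v ⟩
  score (Maybe.map (σ ⟨$⟩ʳ_) (c u′ v′)) u         ≡⟨ score-relabel (c u′ v′) ⟩
  score (c u′ v′) u′                              ≡⟨ sym (W≡score c u′ v′) ⟩
  W c u′ v′                                       ∎
  where
  open ≡-Reasoning
  u′ = σ ⟨$⟩ˡ u
  v′ = σ ⟨$⟩ˡ v
  score-relabel : ∀ o → score (Maybe.map (σ ⟨$⟩ʳ_) o) u ≡ score o u′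
  score-relabel nothing = refl
  score-relabel (just z) with (σ ⟨$⟩ʳ z) ≟ u | z ≟ u′
  ... | yes _    | yes _    = refl
  ... | no _     | no _     = refl
  ... | yes σz≡u | no z≢u′  = ⊥-elim (z≢u′ (trans (sym (inverseˡ σ)) (cong (σ ⟨$⟩ˡ_) σz≡u)))
  ... | no σz≢u  | yes z≡u′ = ⊥-elim (σz≢u (trans (cong (σ ⟨$⟩ʳ_) z≡u′) (inverseʳ σ)))

sumℤ-allFin : ∀ n (h : Fin n → ℤ) → sumℤ (map h (allFin n)) ≡ sum h
sumℤ-allFin n h = trans (cong sumℤ (ListP.map-tabulate (λ i → i) h)) (tabulated h)
  where
  tabulated : ∀ {n} (h : Fin n → ℤ) → sumℤ (tabulate h) ≡ sum h
  tabulated {zero}  h = refl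
  tabulated {suc n} h = cong (λ t → h zero ℤ.+ t) (tabulated (h ∘ suc))

sum-neg : ∀ {n} (h : Fin n → ℤ) → sum (λ i → - h i) ≡ - sum h
sum-neg {zero}  h = refl
sum-neg {suc n} h = trans (cong (λ t → - h zero ℤ.+ t) (sum-neg (h ∘ suc)))
                          (sym (ℤP.neg-distrib-+ (h zero) (sum (h ∘ suc))))

sum-const : ∀ n (z : ℤ) → sum {n} (λ _ → z) ≡ + n ℤ.* z
sum-const zero    z = sym (ℤP.*-zeroˡ z)
sum-const (suc n) z = begin
  z ℤ.+ sum {n} (λ _ → z)   ≡⟨ cong (λ t → z ℤ.+ t) (sum-const n z) ⟩
  z ℤ.+ + n ℤ.* z           ≡⟨ cong (λ t → t ℤ.+ + n ℤ.* z) (sym (ℤP.*-identityˡ z)) ⟩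
  + 1 ℤ.* z ℤ.+ + n ℤ.* z   ≡⟨ sym (ℤP.*-distribʳ-+ z (+ 1) (+ n)) ⟩
  + suc n ℤ.* z             ∎
  where open ≡-Reasoning

-- The cyclic group ℤ/m on Fin m (m = suc m′), with its translations and
-- reflections as permutations

module Cyclic (m′ : ℕ) where

  m : ℕ
  m = suc m′

  infixl 6 _⊕_

  _⊕_ : Fin m → Fin m → Fin m
  a ⊕ b = (toℕ a ℕ.+ toℕ b) mod m

  ⊖_ : Fin m → Fin m
  ⊖ a = (m ℕ.∸ toℕ a) mod m

  toℕ-⊕ : ∀ a b → toℕ (a ⊕ b) ≡ (toℕ a ℕ.+ toℕ b) % m
  toℕ-⊕ a b = toℕ-fromℕ< (m%n<n (toℕ a ℕ.+ toℕ b) m)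

  toℕ-⊖ : ∀ a → toℕ (⊖ a) ≡ (m ℕ.∸ toℕ a) % m
  toℕ-⊖ a = toℕ-fromℕ< (m%n<n (m ℕ.∸ toℕ a) m)

  %-absorbˡ : ∀ x y → (x % m ℕ.+ y) % m ≡ (x ℕ.+ y) % m
  %-absorbˡ x y = begin
    (x % m ℕ.+ y) % m           ≡⟨ %-distribˡ-+ (x % m) y m ⟩
    (x % m % m ℕ.+ y % m) % m   ≡⟨ cong (λ t → (t ℕ.+ y % m) % m) (m%n%n≡m%n x m) ⟩
    (x % m ℕ.+ y % m) % m       ≡⟨ sym (%-distribˡ-+ x y m) ⟩
    (x ℕ.+ y) % m               ∎
    where open ≡-Reasoning

  %-absorbʳ : ∀ x y → (x ℕ.+ y % m) % m ≡ (x ℕ.+ y) % m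
  %-absorbʳ x y = begin
    (x ℕ.+ y % m) % m   ≡⟨ cong (_% m) (ℕP.+-comm x (y % m)) ⟩
    (y % m ℕ.+ x) % m   ≡⟨ %-absorbˡ y x ⟩
    (y ℕ.+ x) % m       ≡⟨ cong (_% m) (ℕP.+-comm y x) ⟩
    (x ℕ.+ y) % m       ∎
    where open ≡-Reasoning

  ⊕-comm : ∀ a b → a ⊕ b ≡ b ⊕ a
  ⊕-comm a b = cong (_mod m) (ℕP.+-comm (toℕ a) (toℕ b))

  ⊕-assoc : ∀ a b c → a ⊕ b ⊕ c ≡ a ⊕ (b ⊕ c)
  ⊕-assoc a b c = toℕ-injective (begin
    toℕ (a ⊕ b ⊕ c)                         ≡⟨ toℕ-⊕ (a ⊕ b) c ⟩
    (toℕ (a ⊕ b) ℕ.+ toℕ c) % m             ≡⟨ cong (λ t → (t ℕ.+ toℕ c) % m) (toℕ-⊕ a b) ⟩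
    ((toℕ a ℕ.+ toℕ b) % m ℕ.+ toℕ c) % m   ≡⟨ %-absorbˡ (toℕ a ℕ.+ toℕ b) (toℕ c) ⟩
    (toℕ a ℕ.+ toℕ b ℕ.+ toℕ c) % m         ≡⟨ cong (_% m) (ℕP.+-assoc (toℕ a) (toℕ b) (toℕ c)) ⟩
    (toℕ a ℕ.+ (toℕ b ℕ.+ toℕ c)) % m       ≡⟨ sym (%-absorbʳ (toℕ a) (toℕ b ℕ.+ toℕ c)) ⟩
    (toℕ a ℕ.+ (toℕ b ℕ.+ toℕ c) % m) % m   ≡⟨ cong (λ t → (toℕ a ℕ.+ t) % m) (sym (toℕ-⊕ b c)) ⟩
    (toℕ a ℕ.+ toℕ (b ⊕ c)) % m             ≡⟨ sym (toℕ-⊕ a (b ⊕ c)) ⟩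
    toℕ (a ⊕ (b ⊕ c))                       ∎)
    where open ≡-Reasoning

  ⊕-identityʳ : ∀ a → a ⊕ zero ≡ a
  ⊕-identityʳ a = toℕ-injective (begin
    toℕ (a ⊕ zero)          ≡⟨ toℕ-⊕ a zero ⟩
    (toℕ a ℕ.+ 0) % m       ≡⟨ cong (_% m) (ℕP.+-identityʳ (toℕ a)) ⟩
    toℕ a % m               ≡⟨ m<n⇒m%n≡m (toℕ<n a) ⟩
    toℕ a                   ∎)
    where open ≡-Reasoning

  ⊕-identityˡ : ∀ a → zero ⊕ a ≡ a
  ⊕-identityˡ a = trans (⊕-comm zero a) (⊕-identityʳ a)

  ⊕-inverseʳ : ∀ a → a ⊕ ⊖ a ≡ zero
  ⊕-inverseʳ a = toℕ-injective (begin
    toℕ (a ⊕ ⊖ a)                       ≡⟨ toℕ-⊕ a (⊖ a) ⟩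
    (toℕ a ℕ.+ toℕ (⊖ a)) % m           ≡⟨ cong (λ t → (toℕ a ℕ.+ t) % m) (toℕ-⊖ a) ⟩
    (toℕ a ℕ.+ (m ℕ.∸ toℕ a) % m) % m   ≡⟨ %-absorbʳ (toℕ a) (m ℕ.∸ toℕ a) ⟩
    (toℕ a ℕ.+ (m ℕ.∸ toℕ a)) % m       ≡⟨ cong (_% m) (ℕP.m+[n∸m]≡n (ℕP.<⇒≤ (toℕ<n a))) ⟩
    m % m                               ≡⟨ n%n≡0 m ⟩
    0                                   ∎)
    where open ≡-Reasoning

  ⊕-inverseˡ : ∀ a → ⊖ a ⊕ a ≡ zero
  ⊕-inverseˡ a = trans (⊕-comm (⊖ a) a) (⊕-inverseʳ a)

  ⊕-cancelʳ : ∀ a b → a ⊕ b ⊕ ⊖ b ≡ a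
  ⊕-cancelʳ a b = begin
    a ⊕ b ⊕ ⊖ b     ≡⟨ ⊕-assoc a b (⊖ b) ⟩
    a ⊕ (b ⊕ ⊖ b)   ≡⟨ cong (a ⊕_) (⊕-inverseʳ b) ⟩
    a ⊕ zero        ≡⟨ ⊕-identityʳ a ⟩
    a               ∎
    where open ≡-Reasoning

  ⊖-involutive : ∀ a → ⊖ ⊖ a ≡ a
  ⊖-involutive a = begin
    ⊖ ⊖ a               ≡⟨ sym (⊕-identityˡ (⊖ ⊖ a)) ⟩
    zero ⊕ ⊖ ⊖ a        ≡⟨ cong (_⊕ ⊖ ⊖ a) (sym (⊕-inverseʳ a)) ⟩
    a ⊕ ⊖ a ⊕ ⊖ ⊖ a     ≡⟨ ⊕-cancelʳ a (⊖ a) ⟩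
    a                   ∎
    where open ≡-Reasoning

  translation : Fin m → Permutation′ m
  translation k = permutation (k ⊕_) (⊖ k ⊕_) undo redo
    where
    undo : ∀ r → k ⊕ (⊖ k ⊕ r) ≡ r
    undo r = trans (sym (⊕-assoc k (⊖ k) r))
                   (trans (cong (_⊕ r) (⊕-inverseʳ k)) (⊕-identityˡ r))
    redo : ∀ r → ⊖ k ⊕ (k ⊕ r) ≡ r
    redo r = trans (sym (⊕-assoc (⊖ k) k r))
                   (trans (cong (_⊕ r) (⊕-inverseˡ k)) (⊕-identityˡ r))

  negation : Permutation′ m
  negation = permutation ⊖_ ⊖_ ⊖-involutive ⊖-involutive

  reflection : Fin m → Permutation′ m
  reflection k = negation ∘ₚ translation k

  sum-translate : ∀ (h : Fin m → ℤ) r → sum (λ k → h (k ⊕ r)) ≡ sum h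
  sum-translate h r = sym (trans (sum-permute h (translation r))
                                 (sum-cong-≗ (λ k → cong h (⊕-comm r k))))

  -- The key cancellation: for antisymmetric F, the translation orbit of
  -- (i , j) is, up to orientation, the translation orbit of (⊖ i , ⊖ j).
  -- Reindexing k ↦ (⊖ i ⊕ ⊖ j) ⊕ k turns one orbit sum into minus the other.
  orbit-cancel : ∀ (F : Fin m → Fin m → ℤ) → Antisymmetric F → ∀ i j →
                 sum (λ k → F (k ⊕ i) (k ⊕ j)) ℤ.+ sum (λ k → F (k ⊕ ⊖ i) (k ⊕ ⊖ j)) ≡ + 0
  orbit-cancel F anti i j =
    trans (cong (ℤ._+ Sneg) reindexed) (ℤP.+-inverseˡ Sneg)
    where
    open ≡-Reasoning
    Sneg = sum (λ k → F (k ⊕ ⊖ i) (k ⊕ ⊖ j))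
    shift : ∀ a b k → (⊖ a ⊕ ⊖ b) ⊕ k ⊕ a ≡ k ⊕ ⊖ b
    shift a b k = begin
      (⊖ a ⊕ ⊖ b) ⊕ k ⊕ a     ≡⟨ cong (_⊕ a) (⊕-comm (⊖ a ⊕ ⊖ b) k) ⟩
      k ⊕ (⊖ a ⊕ ⊖ b) ⊕ a     ≡⟨ ⊕-assoc k (⊖ a ⊕ ⊖ b) a ⟩
      k ⊕ (⊖ a ⊕ ⊖ b ⊕ a)     ≡⟨ cong (k ⊕_) (⊕-assoc (⊖ a) (⊖ b) a) ⟩
      k ⊕ (⊖ a ⊕ (⊖ b ⊕ a))   ≡⟨ cong (λ t → k ⊕ (⊖ a ⊕ t)) (⊕-comm (⊖ b) a) ⟩
      k ⊕ (⊖ a ⊕ (a ⊕ ⊖ b))   ≡⟨ cong (k ⊕_) (sym (⊕-assoc (⊖ a) a (⊖ b))) ⟩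
      k ⊕ (⊖ a ⊕ a ⊕ ⊖ b)     ≡⟨ cong (λ t → k ⊕ (t ⊕ ⊖ b)) (⊕-inverseˡ a) ⟩
      k ⊕ (zero ⊕ ⊖ b)        ≡⟨ cong (k ⊕_) (⊕-identityˡ (⊖ b)) ⟩
      k ⊕ ⊖ b                 ∎
    reindexed : sum (λ k → F (k ⊕ i) (k ⊕ j)) ≡ - Sneg
    reindexed = begin
      sum (λ k → F (k ⊕ i) (k ⊕ j))
        ≡⟨ sum-permute (λ k → F (k ⊕ i) (k ⊕ j)) (translation (⊖ i ⊕ ⊖ j)) ⟩
      sum (λ k → F ((⊖ i ⊕ ⊖ j) ⊕ k ⊕ i) ((⊖ i ⊕ ⊖ j) ⊕ k ⊕ j))
        ≡⟨ sum-cong-≗ (λ k → cong₂ F (shift i j k)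
                                  (trans (cong (λ t → t ⊕ k ⊕ j) (⊕-comm (⊖ i) (⊖ j))) (shift j i k))) ⟩
      sum (λ k → F (k ⊕ ⊖ j) (k ⊕ ⊖ i))
        ≡⟨ sum-cong-≗ (λ k → anti (k ⊕ ⊖ j) (k ⊕ ⊖ i)) ⟩
      sum (λ k → - F (k ⊕ ⊖ i) (k ⊕ ⊖ j))
        ≡⟨ sum-neg (λ k → F (k ⊕ ⊖ i) (k ⊕ ⊖ j)) ⟩
      - Sneg ∎

-- Dihedral averaging on Fin (2 + m): the points 0 and 1 are fixed and
-- the dihedral group of ℤ/m acts on the remaining points 2 + r

module DihedralAverage (m′ : ℕ) where

  open Cyclic m′ public

  N : ℕ
  N = suc (suc m)

  lift₂ : Permutation′ m → Permutation′ N
  lift₂ π = lift₀ (lift₀ π)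

  outer : Fin 2 → Fin N
  outer zero       = zero
  outer (suc zero) = suc zero

  inner : Fin m → Fin N
  inner r = suc (suc r)

  lift₂-outer : ∀ π p → lift₂ π ⟨$⟩ʳ outer p ≡ outer p
  lift₂-outer π zero       = refl
  lift₂-outer π (suc zero) = refl

  orbitSum : (Fin m → Permutation′ m) → (Fin N → Fin N → ℤ) → Fin N → Fin N → ℤ
  orbitSum π G p q = sum (λ k → G (lift₂ (π k) ⟨$⟩ʳ p) (lift₂ (π k) ⟨$⟩ʳ q))

  -- The (unnormalised) average of G over the 2m dihedral symmetries.
  average : (Fin N → Fin N → ℤ) → Fin N → Fin N → ℤ
  average G p q = orbitSum translation G p q ℤ.+ orbitSum reflection G p q

  rowSum : (Fin N → Fin N → ℤ) → Fin N → ℤ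
  rowSum G p = sum (λ t → G p (inner t))

  orbitSum-antisym : ∀ π {G} → Antisymmetric G → Antisymmetric (orbitSum π G)
  orbitSum-antisym π {G} anti p q =
    trans (sum-cong-≗ (λ k → anti (lift₂ (π k) ⟨$⟩ʳ p) (lift₂ (π k) ⟨$⟩ʳ q)))
          (sum-neg (λ k → G (lift₂ (π k) ⟨$⟩ʳ q) (lift₂ (π k) ⟨$⟩ʳ p)))

  average-antisym : ∀ {G} → Antisymmetric G → Antisymmetric (average G)
  average-antisym {G} anti p q =
    trans (cong₂ ℤ._+_ (orbitSum-antisym translation anti p q) (orbitSum-antisym reflection anti p q))
          (sym (ℤP.neg-distrib-+ (orbitSum translation G q p) (orbitSum reflection G q p)))

  -- The fixed pair (0 , 1) is counted once for every symmetry.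
  average-fixed : ∀ G → average G zero (suc zero) ≡ + m ℤ.* G zero (suc zero) ℤ.+ + m ℤ.* G zero (suc zero)
  average-fixed G = cong₂ ℤ._+_ (sum-const m (G zero (suc zero))) (sum-const m (G zero (suc zero)))

  -- A pair (fixed point , moving point) is spread evenly over its row.
  average-row : ∀ G p r → average G (outer p) (inner r) ≡ rowSum G (outer p) ℤ.+ rowSum G (outer p)
  average-row G p r = cong₂ ℤ._+_ (along translation r (λ _ → refl)) (along reflection (⊖ r) (λ _ → refl))
    where
    along : ∀ π s → (∀ k → π k ⟨$⟩ʳ r ≡ k ⊕ s) → orbitSum π G (outer p) (inner r) ≡ rowSum G (outer p)
    along π s πr = trans (sum-cong-≗ (λ k → cong₂ G (lift₂-outer (π k) p) (cong inner (πr k))))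
                         (sum-translate (λ t → G (outer p) (inner t)) s)

  -- Pairs of moving points cancel: translations and reflections together
  -- visit every such pair as often in one orientation as in the other.
  average-inner : ∀ {G} → Antisymmetric G → ∀ i j → average G (inner i) (inner j) ≡ + 0
  average-inner {G} anti = orbit-cancel (λ u v → G (inner u) (inner v)) (λ u v → anti (inner u) (inner v))

transpose-first : ∀ {n} (i j : Fin n) → PC.transpose i j i ≡ j
transpose-first i j with i ≟ i
... | yes _  = refl
... | no i≢i = ⊥-elim (i≢i refl)

transpose-other : ∀ {n} (i j k : Fin n) → k ≢ i → k ≢ j → PC.transpose i j k ≡ k
transpose-other i j k k≢i k≢j with k ≟ i
... | yes k≡i = ⊥-elim (k≢i k≡i)
... | no _ with k ≟ j
...   | yes k≡j = ⊥-elim (k≢j k≡j)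
...   | no _    = refl

-- A permutation of Fin (2 + m) sending 0 ↦ a and 1 ↦ b: first put
-- the preimage of b under (0 a) at position 1, then swap 0 and a.
moveTo : ∀ {m} → Fin (suc (suc m)) → Fin (suc (suc m)) → Permutation′ (suc (suc m))
moveTo a b = transpose (suc zero) (PC.transpose a zero b) ∘ₚ transpose zero a

moveTo-0 : ∀ {m} (a b : Fin (suc (suc m))) → a ≢ b → moveTo a b ⟨$⟩ʳ zero ≡ a
moveTo-0 a b a≢b = begin
  PC.transpose zero a (PC.transpose (suc zero) b′ zero)
    ≡⟨ cong (PC.transpose zero a) (transpose-other (suc zero) b′ zero (λ ()) 0≢b′) ⟩
  PC.transpose zero a zero
    ≡⟨ transpose-first zero a ⟩
  a ∎
  where
  open ≡-Reasoning
  b′ = PC.transpose a zero b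
  0≢b′ : zero ≢ b′
  0≢b′ 0≡b′ = a≢b (begin
    a                              ≡⟨ sym (transpose-first zero a) ⟩
    PC.transpose zero a zero       ≡⟨ cong (PC.transpose zero a) 0≡b′ ⟩
    PC.transpose zero a b′         ≡⟨ PC.transpose-inverse zero a ⟩
    b                              ∎)

moveTo-1 : ∀ {m} (a b : Fin (suc (suc m))) → moveTo a b ⟨$⟩ʳ suc zero ≡ b
moveTo-1 a b = trans (cong (PC.transpose zero a) (transpose-first (suc zero) (PC.transpose a zero b)))
                     (PC.transpose-inverse zero a)

-- A choice function seen from an ordered pair (a , b): relabel so that a
-- and b sit at positions 0 and 1, and read off the dihedral average

module PairView (m′ : ℕ) {c : RawChoice (suc (suc (suc m′)))} (isC : IsChoiceFn c) where

  open DihedralAverage m′ public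

  relabelled : Fin N → Fin N → Fin N → Fin N → ℤ
  relabelled a b p q = W c (moveTo a b ⟨$⟩ʳ p) (moveTo a b ⟨$⟩ʳ q)

  relabelled-antisym : ∀ a b → Antisymmetric (relabelled a b)
  relabelled-antisym a b p q = W-antisym isC (moveTo a b ⟨$⟩ʳ p) (moveTo a b ⟨$⟩ʳ q)

  relabelled-fixed : ∀ a b → a ≢ b → relabelled a b zero (suc zero) ≡ W c a b
  relabelled-fixed a b a≢b = cong₂ (W c) (moveTo-0 a b a≢b) (moveTo-1 a b)

  valence-split : ∀ a b → a ≢ b → ∀ w →
                  val c w ≡ W c w a ℤ.+ (W c w b ℤ.+ sum (λ t → W c w (moveTo a b ⟨$⟩ʳ inner t)))
  valence-split a b a≢b w = begin
    val c w                                          ≡⟨ sumℤ-allFin N (W c w) ⟩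
    sum (W c w)                                      ≡⟨ sum-permute (W c w) (moveTo a b) ⟩
    sum (λ i → W c w (moveTo a b ⟨$⟩ʳ i))            ≡⟨ cong₂ (λ s t → W c w s ℤ.+ (W c w t ℤ.+ R))
                                                              (moveTo-0 a b a≢b) (moveTo-1 a b) ⟩
    W c w a ℤ.+ (W c w b ℤ.+ R)                      ∎
    where
    open ≡-Reasoning
    R = sum (λ t → W c w (moveTo a b ⟨$⟩ʳ inner t))

  open +-*-Solver

  rowSum-first : ∀ a b → a ≢ b → rowSum (relabelled a b) zero ≡ val c a ℤ.- W c a b
  rowSum-first a b a≢b = begin
    rowSum (relabelled a b) zero
      ≡⟨ sum-cong-≗ (λ t → cong (λ s → W c s (moveTo a b ⟨$⟩ʳ inner t)) (moveTo-0 a b a≢b)) ⟩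
    R
      ≡⟨ solve 2 (λ r w → r := (con (+ 0) :+ (w :+ r)) :- w) refl R (W c a b) ⟩
    (+ 0 ℤ.+ (W c a b ℤ.+ R)) ℤ.- W c a b
      ≡⟨ cong (λ t → (t ℤ.+ (W c a b ℤ.+ R)) ℤ.- W c a b) (sym (antisym-diag (W-antisym isC) a)) ⟩
    (W c a a ℤ.+ (W c a b ℤ.+ R)) ℤ.- W c a b
      ≡⟨ cong (ℤ._- W c a b) (sym (valence-split a b a≢b a)) ⟩
    val c a ℤ.- W c a b ∎
    where
    open ≡-Reasoning
    R = sum (λ t → W c a (moveTo a b ⟨$⟩ʳ inner t))

  rowSum-second : ∀ a b → a ≢ b → rowSum (relabelled a b) (suc zero) ≡ val c b ℤ.+ W c a b
  rowSum-second a b a≢b = begin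
    rowSum (relabelled a b) (suc zero)
      ≡⟨ sum-cong-≗ (λ t → cong (λ s → W c s (moveTo a b ⟨$⟩ʳ inner t)) (moveTo-1 a b)) ⟩
    R
      ≡⟨ solve 2 (λ r w → r := ((:- w) :+ (con (+ 0) :+ r)) :+ w) refl R (W c a b) ⟩
    (- W c a b ℤ.+ (+ 0 ℤ.+ R)) ℤ.+ W c a b
      ≡⟨ cong₂ (λ s t → (s ℤ.+ (t ℤ.+ R)) ℤ.+ W c a b) (sym (W-antisym isC b a)) (sym (antisym-diag (W-antisym isC) b)) ⟩
    (W c b a ℤ.+ (W c b b ℤ.+ R)) ℤ.+ W c a b
      ≡⟨ cong (ℤ._+ W c a b) (sym (valence-split a b a≢b b)) ⟩
    val c b ℤ.+ W c a b ∎
    where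
    open ≡-Reasoning
    R = sum (λ t → W c b (moveTo a b ⟨$⟩ʳ inner t))

toℚᵘ-toℚ : ∀ z → ℚ.toℚᵘ (toℚ z) ≃ᵘ mkℚᵘ z 0
toℚᵘ-toℚ z = ℚP.toℚᵘ-fromℚᵘ (mkℚᵘ z 0)

toℚ-+ : ∀ a b → toℚ (a ℤ.+ b) ≡ toℚ a + toℚ b
toℚ-+ a b = ℚP.toℚᵘ-injective (ℚᵘP.≃-trans (toℚᵘ-toℚ (a ℤ.+ b)) (ℚᵘP.≃-trans over1
  (ℚᵘP.≃-sym (ℚᵘP.≃-trans (ℚP.toℚᵘ-homo-+ (toℚ a) (toℚ b)) (ℚᵘP.+-cong (toℚᵘ-toℚ a) (toℚᵘ-toℚ b))))))
  where
  open +-*-Solver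
  over1 : mkℚᵘ (a ℤ.+ b) 0 ≃ᵘ mkℚᵘ a 0 ℚᵘ.+ mkℚᵘ b 0
  over1 = *≡* (solve 2 (λ a b → (a :+ b) :* con (+ 1) := (a :* con (+ 1) :+ b :* con (+ 1)) :* con (+ 1)) refl a b)

toℚ-* : ∀ a b → toℚ (a ℤ.* b) ≡ toℚ a * toℚ b
toℚ-* a b = ℚP.toℚᵘ-injective (ℚᵘP.≃-trans (toℚᵘ-toℚ (a ℤ.* b)) (ℚᵘP.≃-trans over1
  (ℚᵘP.≃-sym (ℚᵘP.≃-trans (ℚP.toℚᵘ-homo-* (toℚ a) (toℚ b)) (ℚᵘP.*-cong (toℚᵘ-toℚ a) (toℚᵘ-toℚ b))))))
  where
  open +-*-Solver
  over1 : mkℚᵘ (a ℤ.* b) 0 ≃ᵘ mkℚᵘ a 0 ℚᵘ.* mkℚᵘ b 0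
  over1 = *≡* (solve 2 (λ a b → (a :* b) :* con (+ 1) := (a :* b) :* con (+ 1)) refl a b)

toℚ-neg : ∀ a → toℚ (- a) ≡ ℚ.- toℚ a
toℚ-neg a = ℚP.toℚᵘ-injective (ℚᵘP.≃-trans (toℚᵘ-toℚ (- a))
  (ℚᵘP.≃-sym (ℚᵘP.≃-trans (ℚP.toℚᵘ-homo‿- (toℚ a)) (ℚᵘP.-‿cong (toℚᵘ-toℚ a)))))

∑ : ∀ {A : Set} → List A → (A → ℚ) → ℚ
∑ xs h = sumℚ (map h xs)

∑-++ : ∀ {A : Set} (xs ys : List A) h → ∑ (xs ++ ys) h ≡ ∑ xs h + ∑ ys h
∑-++ []       ys h = sym (ℚP.+-identityˡ (∑ ys h))
∑-++ (x ∷ xs) ys h = trans (cong (λ t → h x + t) (∑-++ xs ys h)) (sym (ℚP.+-assoc (h x) (∑ xs h) (∑ ys h)))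

∑-concatMap : ∀ {A B : Set} (xs : List A) (g : A → List B) h → ∑ (concatMap g xs) h ≡ ∑ xs (λ x → ∑ (g x) h)
∑-concatMap []       g h = refl
∑-concatMap (x ∷ xs) g h = trans (∑-++ (g x) (concatMap g xs) h) (cong (λ t → ∑ (g x) h + t) (∑-concatMap xs g h))

∑-map : ∀ {A B : Set} (xs : List A) (g : A → B) h → ∑ (map g xs) h ≡ ∑ xs (h ∘ g)
∑-map []       g h = refl
∑-map (x ∷ xs) g h = cong (λ t → h (g x) + t) (∑-map xs g h)

∑-congᴾ : ∀ {A : Set} {P : A → Set} {h h′ : A → ℚ} (xs : List A) →
          ListAll.All P xs → (∀ x → P x → h x ≡ h′ x) → ∑ xs h ≡ ∑ xs h′
∑-congᴾ []       []         eq = refl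
∑-congᴾ (x ∷ xs) (px ∷ pxs) eq = cong₂ _+_ (eq x px) (∑-congᴾ xs pxs eq)

∑-cong : ∀ {A : Set} {h h′ : A → ℚ} (xs : List A) → (∀ x → h x ≡ h′ x) → ∑ xs h ≡ ∑ xs h′
∑-cong []       eq = refl
∑-cong (x ∷ xs) eq = cong₂ _+_ (eq x) (∑-cong xs eq)

∑-*ˡ : ∀ {A : Set} (xs : List A) r h → ∑ xs (λ x → r * h x) ≡ r * ∑ xs h
∑-*ˡ []       r h = sym (ℚP.*-zeroʳ r)
∑-*ˡ (x ∷ xs) r h = trans (cong (λ t → r * h x + t) (∑-*ˡ xs r h)) (sym (ℚP.*-distribˡ-+ r (h x) (∑ xs h)))

∑-*ʳ : ∀ {A : Set} (xs : List A) r h → ∑ xs (λ x → h x * r) ≡ ∑ xs h * r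
∑-*ʳ []       r h = sym (ℚP.*-zeroˡ r)
∑-*ʳ (x ∷ xs) r h = trans (cong (λ t → h x * r + t) (∑-*ʳ xs r h)) (sym (ℚP.*-distribʳ-+ r (h x) (∑ xs h)))

∑-neg : ∀ {A : Set} (xs : List A) h → ∑ xs (λ x → ℚ.- h x) ≡ ℚ.- ∑ xs h
∑-neg []       h = refl
∑-neg (x ∷ xs) h = trans (cong (λ t → ℚ.- h x + t) (∑-neg xs h)) (sym (ℚP.neg-distrib-+ (h x) (∑ xs h)))

∑-zero : ∀ {A : Set} (xs : List A) → ∑ xs (λ _ → 0ℚ) ≡ 0ℚ
∑-zero []       = refl
∑-zero (x ∷ xs) = trans (ℚP.+-identityˡ (∑ xs (λ _ → 0ℚ))) (∑-zero xs)

*-nonNeg : ∀ {p q} → 0ℚ ≤ p → 0ℚ ≤ q → 0ℚ ≤ p * q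
*-nonNeg {p} {q} p≥0 q≥0 =
  ℚP.nonNegative⁻¹ (p * q) {{ℚP.nonNeg*nonNeg⇒nonNeg p {{ℚ.nonNegative p≥0}} q {{ℚ.nonNegative q≥0}}}}

∑-rescaled : ∀ {A : Set} (xs : List A) r (w : A → ℚ) (q : A → Point) →
             r ·ᵖ foldr _+ᵖ_ 0ᵖ (map (λ i → w i ·ᵖ q i) xs)
             ≡ (∑ xs (λ i → (r * w i) * proj₁ (q i)) , ∑ xs (λ i → (r * w i) * proj₂ (q i)))
∑-rescaled []       r w q = cong₂ _,_ (ℚP.*-zeroʳ r) (ℚP.*-zeroʳ r)
∑-rescaled (i ∷ xs) r w q = cong₂ _,_
  (trans (distrib (w i) (proj₁ (q i)) _) (cong (λ t → (r * w i) * proj₁ (q i) + t) (cong proj₁ rest)))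
  (trans (distrib (w i) (proj₂ (q i)) _) (cong (λ t → (r * w i) * proj₂ (q i) + t) (cong proj₂ rest)))
  where
  open ℚSolver.+-*-Solver
  rest = ∑-rescaled xs r w q
  distrib : ∀ a b t → r * (a * b + t) ≡ (r * a) * b + r * t
  distrib = solve 4 (λ r a b t → r :* (a :* b :+ t) := (r :* a) :* b :+ r :* t) refl r

∑-integers : ∀ m (f : Fin m → ℤ) w → ∑ (allFin m) (λ k → toℚ (f k) * w) ≡ toℚ (sum f) * w
∑-integers m f w = trans (over-list (allFin m)) (cong (λ z → toℚ z * w) (sumℤ-allFin m f))
  where
  over-list : ∀ ks → ∑ ks (λ k → toℚ (f k) * w) ≡ toℚ (sumℤ (map f ks)) * w
  over-list []       = sym (ℚP.*-zeroˡ w)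
  over-list (k ∷ ks) = begin
    toℚ (f k) * w + ∑ ks (λ k → toℚ (f k) * w)    ≡⟨ cong (λ t → toℚ (f k) * w + t) (over-list ks) ⟩
    toℚ (f k) * w + toℚ (sumℤ (map f ks)) * w     ≡⟨ sym (ℚP.*-distribʳ-+ w (toℚ (f k)) _) ⟩
    (toℚ (f k) + toℚ (sumℤ (map f ks))) * w       ≡⟨ cong (_* w) (sym (toℚ-+ (f k) _)) ⟩
    toℚ (f k ℤ.+ sumℤ (map f ks)) * w             ∎
    where open ≡-Reasoning

toDefsAll : ∀ {A : Set} {P Q : A → Set} {xs} → (∀ {x} → P x → Q x) → ListAll.All P xs → All Q xs
toDefsAll f []         = []
toDefsAll f (px ∷ pxs) = f px ∷ toDefsAll f pxs

all-map-allFin : ∀ {A : Set} {P : A → Set} {m} (f : Fin m → A) → (∀ i → P (f i)) → ListAll.All P (map f (allFin m))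
all-map-allFin f Pf = ListAllP.map⁺ (ListAllP.tabulate⁺ Pf)

∑-const : ∀ m w → ∑ (allFin m) (λ _ → w) ≡ toℚ (+ m) * w
∑-const m w = begin
  ∑ (allFin m) (λ _ → w)                 ≡⟨ ∑-cong (allFin m) (λ _ → sym (ℚP.*-identityˡ w)) ⟩
  ∑ (allFin m) (λ _ → toℚ (+ 1) * w)     ≡⟨ ∑-integers m (λ _ → + 1) w ⟩
  toℚ (sum {m} (λ _ → + 1)) * w          ≡⟨ cong (λ z → toℚ z * w) (trans (sum-const m (+ 1)) (ℤP.*-identityʳ (+ m))) ⟩
  toℚ (+ m) * w                          ∎
  where open ≡-Reasoning

weight≤total : ∀ {A : Set} (ρ : A → ℚ) (xs : List A) →
               ListAll.All (λ x → 0ℚ ≤ ρ x) xs → ListAll.All (λ x → ρ x ≤ ∑ xs ρ) xs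
weight≤total ρ []       []         = []
weight≤total ρ (x ∷ xs) (ρx≥0 ∷ ps) =
  ≤-shift (ℚP.+-monoʳ-≤ (ρ x) (total≥0 xs ps)) (ℚP.+-identityʳ (ρ x))
  ∷ ListAll.map (λ ρy≤ → ℚP.≤-trans ρy≤ (≤-shift (ℚP.+-monoˡ-≤ (∑ xs ρ) ρx≥0) (ℚP.+-identityˡ (∑ xs ρ))))
                (weight≤total ρ xs ps)
  where
  ≤-shift : ∀ {a b c} → a ≤ c → a ≡ b → b ≤ c
  ≤-shift a≤c refl = a≤c
  total≥0 : ∀ ys → ListAll.All (λ y → 0ℚ ≤ ρ y) ys → 0ℚ ≤ ∑ ys ρ
  total≥0 []       []        = ℚP.≤-refl
  total≥0 (y ∷ ys) (p ∷ ps′) = ℚP.+-mono-≤ p (total≥0 ys ps′)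

-- Certificates of valence imbalance as weighted lists of ordered pairs

WeightedPair : ℕ → Set
WeightedPair n = ℚ × Fin n × Fin n

weight : ∀ {n} → WeightedPair n → ℚ
weight = proj₁

Proper : ∀ {n} → WeightedPair n → Set
Proper (ρ , a , b) = (0ℚ ≤ ρ) × a ≢ b

reversed : ∀ {n} → WeightedPair n → WeightedPair n
reversed (ρ , a , b) = (ρ , b , a)

module _ {n} (c : RawChoice n) where

  -- The weighted point (val a − W^a_b , val b + W^a_b) of V_ℓ(c) and the
  -- weighted match value W^a_b, for ℓ = W^a_b.
  firstCoord secondCoord matchValue : WeightedPair n → ℚ
  firstCoord  (ρ , a , b) = ρ * toℚ (val c a ℤ.- W c a b)
  secondCoord (ρ , a , b) = ρ * toℚ (val c b ℤ.+ W c a b)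
  matchValue  (ρ , a , b) = ρ * toℚ (W c a b)

  record Realises (r : ℚ) (p : Point) (s : ℚ) : Set where
    field
      pairs   : List (WeightedPair n)
      proper  : ListAll.All Proper pairs
      total   : ∑ pairs weight ≡ r
      firsts  : ∑ pairs firstCoord ≡ proj₁ p
      seconds : ∑ pairs secondCoord ≡ proj₂ p
      matches : ∑ pairs matchValue ≡ s

  record Witness (ℓ : ℤ) (q : Point) : Set where
    constructor witness
    field
      a b      : Fin n
      distinct : a ≢ b
      match    : W c a b ≡ ℓ
      point    : q ≡ (toℚ (val c a ℤ.- ℓ) , toℚ (val c b ℤ.+ ℓ))

  V-witness : ∀ ℓ {q} → q ∈ V ℓ c → Witness ℓ q
  V-witness ℓ q∈V with ∈-map⁻ (λ p → toℚ (val c (proj₁ p) ℤ.- ℓ) , toℚ (val c (proj₂ p) ℤ.+ ℓ)) q∈V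
  ... | (a , b) , ab∈ , q≡ with ∈-filter⁻ (λ p → ¬? (proj₁ p ≟ proj₂ p) ×-dec (W c (proj₁ p) (proj₂ p) ℤ.≟ ℓ))
                                          {xs = allPairs n} ab∈
  ...   | _ , a≢b , Wab≡ℓ = witness a b a≢b Wab≡ℓ q≡

  -- A point r·v with v in the hull of V_ℓ(c) is realised by the pairs
  -- behind the points of the convex combination, reweighted by r.
  realises-hull : ∀ ℓ {r v} → 0ℚ ≤ r → InConv (V ℓ c) v → Realises r (r ·ᵖ v) (r * toℚ ℓ)
  realises-hull ℓ {r} {v} r≥0 (w , w≥0 , w-total , v≡) = record
    { pairs   = map pairOf (allFin len)
    ; proper  = all-map-allFin pairOf (λ i → *-nonNeg r≥0 (w≥0 i) , distinct i)
    ; total   = trans (∑-map (allFin len) pairOf weight) weights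
    ; firsts  = trans (∑-map (allFin len) pairOf firstCoord) (trans (∑-cong (allFin len) first≡) (cong proj₁ (sym rescaled)))
    ; seconds = trans (∑-map (allFin len) pairOf secondCoord) (trans (∑-cong (allFin len) second≡) (cong proj₂ (sym rescaled)))
    ; matches = trans (∑-map (allFin len) pairOf matchValue) (trans (∑-cong (allFin len) match≡)
                      (trans (∑-*ʳ (allFin len) (toℚ ℓ) (λ i → r * w i)) (cong (_* toℚ ℓ) weights)))
    }
    where
    open ≡-Reasoning
    S = V ℓ c
    len = length S
    open module Wit i = Witness (V-witness ℓ (∈-lookup {xs = S} i))
    pairOf : Fin len → WeightedPair n
    pairOf i = (r * w i , a i , b i)
    weights : ∑ (allFin len) (λ i → r * w i) ≡ r
    weights = begin
      ∑ (allFin len) (λ i → r * w i)   ≡⟨ ∑-*ˡ (allFin len) r w ⟩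
      r * ∑ (allFin len) w             ≡⟨ cong (r *_) w-total ⟩
      r * 1ℚ                           ≡⟨ ℚP.*-identityʳ r ⟩
      r                                ∎
    rescaled : r ·ᵖ v ≡ ( ∑ (allFin len) (λ i → (r * w i) * proj₁ (lookup S i))
                        , ∑ (allFin len) (λ i → (r * w i) * proj₂ (lookup S i)))
    rescaled = trans (cong (r ·ᵖ_) v≡) (∑-rescaled (allFin len) r w (lookup S))
    first≡ : ∀ i → firstCoord (pairOf i) ≡ (r * w i) * proj₁ (lookup S i)
    first≡ i = trans (cong (λ z → (r * w i) * toℚ (val c (a i) ℤ.- z)) (match i))
                     (cong (λ q → (r * w i) * proj₁ q) (sym (point i)))
    second≡ : ∀ i → secondCoord (pairOf i) ≡ (r * w i) * proj₂ (lookup S i)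
    second≡ i = trans (cong (λ z → (r * w i) * toℚ (val c (b i) ℤ.+ z)) (match i))
                      (cong (λ q → (r * w i) * proj₂ q) (sym (point i)))
    match≡ : ∀ i → matchValue (pairOf i) ≡ (r * w i) * toℚ ℓ
    match≡ i = cong (λ z → (r * w i) * toℚ z) (match i)

  realises-term : ∀ ℓ {r v} → 0ℚ ≤ r → r ≡ 0ℚ ⊎ InConv (V ℓ c) v → Realises r (r ·ᵖ v) (r * toℚ ℓ)
  realises-term ℓ {v = v} _ (inj₁ refl) = record
    { pairs = [] ; proper = [] ; total = refl
    ; firsts  = sym (ℚP.*-zeroˡ (proj₁ v))
    ; seconds = sym (ℚP.*-zeroˡ (proj₂ v))
    ; matches = sym (ℚP.*-zeroˡ (toℚ ℓ))
    }
  realises-term ℓ r≥0 (inj₂ v∈hull) = realises-hull ℓ r≥0 v∈hull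

  realises-++ : ∀ {r r′ p p′ s s′} → Realises r p s → Realises r′ p′ s′ →
                Realises (r + r′) (p +ᵖ p′) (s + s′)
  realises-++ P Q = record
    { pairs   = P.pairs ++ Q.pairs
    ; proper  = ListAllP.++⁺ P.proper Q.proper
    ; total   = trans (∑-++ P.pairs Q.pairs weight) (cong₂ _+_ P.total Q.total)
    ; firsts  = trans (∑-++ P.pairs Q.pairs firstCoord) (cong₂ _+_ P.firsts Q.firsts)
    ; seconds = trans (∑-++ P.pairs Q.pairs secondCoord) (cong₂ _+_ P.seconds Q.seconds)
    ; matches = trans (∑-++ P.pairs Q.pairs matchValue) (cong₂ _+_ P.matches Q.matches)
    }
    where
    module P = Realises P
    module Q = Realises Q

  realises-cast : ∀ {r r′ p p′ s} → r ≡ r′ → p ≡ p′ → Realises r p s → Realises r′ p′ s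
  realises-cast refl refl R = R

  realises-reverse : IsChoiceFn c → ∀ {r p s} → Realises r p s → Realises r (proj₂ p , proj₁ p) (ℚ.- s)
  realises-reverse isC R = record
    { pairs   = map reversed pairs
    ; proper  = ListAllP.map⁺ (ListAll.map (λ (ρ≥0 , a≢b) → ρ≥0 , a≢b ∘ sym) proper)
    ; total   = trans (∑-map pairs reversed weight) total
    ; firsts  = trans (∑-map pairs reversed firstCoord) (trans (∑-cong pairs first≡second) seconds)
    ; seconds = trans (∑-map pairs reversed secondCoord) (trans (∑-cong pairs second≡first) firsts)
    ; matches = trans (∑-map pairs reversed matchValue)
                      (trans (∑-cong pairs match≡neg) (trans (∑-neg pairs matchValue) (cong ℚ.-_ matches)))
    }
    where
    open Realises R
    first≡second : ∀ e → firstCoord (reversed e) ≡ secondCoord e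
    first≡second (ρ , a , b) =
      cong (λ z → ρ * toℚ (val c b ℤ.+ z)) (trans (cong -_ (W-antisym isC b a)) (ℤP.neg-involutive (W c a b)))
    second≡first : ∀ e → secondCoord (reversed e) ≡ firstCoord e
    second≡first (ρ , a , b) = cong (λ z → ρ * toℚ (val c a ℤ.+ z)) (W-antisym isC b a)
    match≡neg : ∀ e → matchValue (reversed e) ≡ ℚ.- matchValue e
    match≡neg (ρ , a , b) = begin
      ρ * toℚ (W c b a)           ≡⟨ cong (λ z → ρ * toℚ z) (W-antisym isC b a) ⟩
      ρ * toℚ (- W c a b)         ≡⟨ cong (ρ *_) (toℚ-neg (W c a b)) ⟩
      ρ * ℚ.- toℚ (W c a b)       ≡⟨ sym (ℚP.neg-distribʳ-* ρ (toℚ (W c a b))) ⟩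
      ℚ.- (ρ * toℚ (W c a b))     ∎
      where open ≡-Reasoning

Certificate : ∀ {n} → RawChoice n → Set
Certificate c = Σ ℚ λ s → 0ℚ < s × Realises c 1ℚ 0ᵖ s

-- Valence imbalance yields a certificate: the three hull points give
-- pairs with match values −1, 0, 1, so the total match value is
-- r₁ − r₋₁ ≠ 0, and reversing all pairs if necessary makes it positive.
imbalanced⇒certificate : ∀ {n} {c : RawChoice n} → IsChoiceFn c → ValenceImbalanced c → Certificate c
imbalanced⇒certificate {c = c} isC
  (rm , r0 , rp , vm , v0 , vp , (rm≥0 , _) , (r0≥0 , _) , (rp≥0 , _) , sum≡1 , rm≢rp , hm , h0 , hp , balance) =
  orient (ℚP.<-cmp 0ℚ s)
  where
  open ℚSolver.+-*-Solver
  s : ℚ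
  s = rm * toℚ (- (+ 1)) + (r0 * toℚ (+ 0) + rp * toℚ (+ 1))
  R : Realises c 1ℚ 0ᵖ s
  R = realises-cast c (trans (sym (ℚP.+-assoc rm r0 rp)) sum≡1) (sym balance)
        (realises-++ c (realises-term c (- (+ 1)) rm≥0 hm)
                       (realises-++ c (realises-term c (+ 0) r0≥0 h0) (realises-term c (+ 1) rp≥0 hp)))
  rp≡s+rm : rp ≡ s + rm
  rp≡s+rm = solve 3 (λ a b c → c := (a :* (:- con 1ℚ) :+ (b :* con 0ℚ :+ c :* con 1ℚ)) :+ a) refl rm r0 rp
  orient : Tri (0ℚ < s) (0ℚ ≡ s) (s < 0ℚ) → Certificate c
  orient (tri< s>0 _ _) = s , s>0 , R
  orient (tri≈ _ 0≡s _) = ⊥-elim (rm≢rp (sym (trans rp≡s+rm (trans (cong (_+ rm) (sym 0≡s)) (ℚP.+-identityˡ rm)))))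
  orient (tri> _ _ s<0) = ℚ.- s , ℚP.neg-antimono-< s<0 , realises-reverse c isC R

SamePair : ∀ {n} → Fin n → Fin n → Fin n → Fin n → Set
SamePair x y u v = (u ≡ x × v ≡ y) ⊎ (u ≡ y × v ≡ x)

samePair? : ∀ {n} (x y u v : Fin n) → Dec (SamePair x y u v)
samePair? x y u v = (u ≟ x ×-dec v ≟ y) ⊎-dec (u ≟ y ×-dec v ≟ x)

samePair-swap : ∀ {n} {x y u v : Fin n} → SamePair x y u v → SamePair x y v u
samePair-swap (inj₁ (u≡x , v≡y)) = inj₂ (v≡y , u≡x)
samePair-swap (inj₂ (u≡y , v≡x)) = inj₁ (v≡x , u≡y)

onlyPair : ∀ {n} → Fin n → Fin n → RawChoice n
onlyPair x y u v with samePair? x y u v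
... | yes _ = just x
... | no _  = nothing

module _ {n} {x y : Fin n} (x≢y : x ≢ y) where

  onlyPair-choice : IsChoiceFn (onlyPair x y)
  onlyPair-choice = record { unordered = unordered ; noDiag = noDiag ; chooses = chooses }
    where
    unordered : ∀ u v → onlyPair x y u v ≡ onlyPair x y v u
    unordered u v with samePair? x y u v | samePair? x y v u
    ... | yes _  | yes _  = refl
    ... | no _   | no _   = refl
    ... | yes uv | no ¬vu = ⊥-elim (¬vu (samePair-swap uv))
    ... | no ¬uv | yes vu = ⊥-elim (¬uv (samePair-swap vu))
    noDiag : ∀ u → onlyPair x y u u ≡ nothing
    noDiag u with samePair? x y u u
    ... | yes (inj₁ (u≡x , u≡y)) = ⊥-elim (x≢y (trans (sym u≡x) u≡y))
    ... | yes (inj₂ (u≡y , u≡x)) = ⊥-elim (x≢y (trans (sym u≡x) u≡y))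
    ... | no _ = refl
    chooses : ∀ u v z → onlyPair x y u v ≡ just z → z ≡ u ⊎ z ≡ v
    chooses u v z eq with samePair? x y u v | eq
    ... | yes (inj₁ (u≡x , _)) | refl = inj₁ (sym u≡x)
    ... | yes (inj₂ (_ , v≡x)) | refl = inj₂ (sym v≡x)
    ... | no _                 | ()

  onlyPair-domain : DomIsPair (onlyPair x y) x y
  onlyPair-domain u v = mk⇔ to from
    where
    to : onlyPair x y u v ≢ nothing → SamePair x y u v
    to defined with samePair? x y u v
    ... | yes uv = uv
    ... | no _   = ⊥-elim (defined refl)
    from : SamePair x y u v → onlyPair x y u v ≢ nothing
    from uv with samePair? x y u v
    ... | yes _  = λ ()
    ... | no ¬uv = ⊥-elim (¬uv uv)

  onlyPair-majority : (w : Fin n → Fin n → ℚ) → 0ℚ < w x y → w y x ≡ ℚ.- w x y →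
                      (∀ u v → ¬ SamePair x y u v → w u v ≡ 0ℚ) →
                      ∀ u v → (onlyPair x y u v ≡ just u) ⇔ (0ℚ < w u v)
  onlyPair-majority w wxy>0 wyx≡ off u v with samePair? x y u v
  ... | yes (inj₁ (refl , refl)) = mk⇔ (λ _ → wxy>0) (λ _ → refl)
  ... | yes (inj₂ (refl , refl)) = mk⇔ (λ x≡y → ⊥-elim (x≢y (just-injective x≡y)))
                                       (λ wyx>0 → ⊥-elim (ℚP.<-asym (subst (0ℚ <_) wyx≡ wyx>0) (ℚP.neg-antimono-< wxy>0)))
    where
    just-injective : ∀ {a b : Fin n} → just a ≡ just b → a ≡ b
    just-injective refl = refl
  ... | no ¬uv = mk⇔ (λ ()) (λ w>0 → ⊥-elim (ℚP.<-irrefl refl (subst (0ℚ <_) (off u v ¬uv) w>0)))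

-- From a certificate to a majority verdict on the single pair {x , y}
--
-- Each certificate pair (ρ , a , b) contributes the 2m copies of c
-- relabelled by a ↦ x , b ↦ y followed by the dihedral symmetries of
-- the remaining points, each with weight ρ/(2m).  The weighted margin
-- on (u , v) is then the ρ-weighted dihedral average of the relabelled
-- matrices at the positions of u and v.

module Construction (m′ : ℕ) (𝒞 : RawChoice (suc (suc (suc m′))) → Set) (symm : Symmetric 𝒞)
                    {c : RawChoice (suc (suc (suc m′)))} (c∈𝒞 : 𝒞 c) (isC : IsChoiceFn c)
                    {x y : Fin (suc (suc (suc m′)))} (x≢y : x ≢ y) (cert : Certificate c) where

  open PairView m′ isC
  open Realises (proj₂ (proj₂ cert))

  share : ℚ
  share = + 1 / (m ℕ.+ m)

  share-total : toℚ (+ m ℤ.+ + m) * share ≡ 1ℚ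
  share-total = ℚP.toℚᵘ-injective (ℚᵘP.≃-trans (ℚP.toℚᵘ-homo-* (toℚ (+ m ℤ.+ + m)) share)
    (ℚᵘP.≃-trans (ℚᵘP.*-cong (toℚᵘ-toℚ (+ m ℤ.+ + m)) (ℚP.toℚᵘ-fromℚᵘ (mkℚᵘ (+ 1) (m′ ℕ.+ m))))
                 (*≡* cross)))
    where
    open +-*-Solver
    cross : ((+ m ℤ.+ + m) ℤ.* + 1) ℤ.* + 1 ≡ + 1 ℤ.* (+ 1 ℤ.* (+ m ℤ.+ + m))
    cross = solve 1 (λ k → (k :* con (+ 1)) :* con (+ 1) := con (+ 1) :* (con (+ 1) :* k)) refl (+ m ℤ.+ + m)

  share≥0 : 0ℚ ≤ share
  share≥0 = ℚP.<⇒≤ (ℚP.positive⁻¹ share {{ℚP.normalize-pos 1 (m ℕ.+ m)}})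

  position : Fin N → Fin N
  position u = moveTo x y ⟨$⟩ˡ u

  position-x : position x ≡ zero
  position-x = trans (cong position (sym (moveTo-0 x y x≢y))) (inverseˡ (moveTo x y))

  position-y : position y ≡ suc zero
  position-y = trans (cong position (sym (moveTo-1 x y))) (inverseˡ (moveTo x y))

  from-position : ∀ {u p} → position u ≡ p → u ≡ moveTo x y ⟨$⟩ʳ p
  from-position {u} refl = sym (inverseʳ (moveTo x y))

  first second : WeightedPair N → Fin N
  first  (_ , a , _) = a
  second (_ , _ , b) = b

  view : WeightedPair N → Fin N → Fin N → ℤ
  view e = relabelled (first e) (second e)

  view-antisym : ∀ e → Antisymmetric (view e)
  view-antisym e = relabelled-antisym (first e) (second e)

  -- The relabelling whose inverse moves x , y to 0 , 1, applies the k-th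
  -- symmetry π k, and moves 0 , 1 to the pair of e.
  relabelling : (Fin m → Permutation′ m) → WeightedPair N → Fin m → Permutation′ N
  relabelling π e k = flip (flip (moveTo x y) ∘ₚ lift₂ (π k) ∘ₚ moveTo (first e) (second e))

  copy : (Fin m → Permutation′ m) → WeightedPair N → Fin m → RawChoice N
  copy π e k = permute (relabelling π e k) c

  copiesBy : (Fin m → Permutation′ m) → WeightedPair N → List (RawChoice N × ℚ)
  copiesBy π e = map (λ k → copy π e k , weight e * share) (allFin m)

  copies : WeightedPair N → List (RawChoice N × ℚ)
  copies e = copiesBy translation e ++ copiesBy reflection e

  votes : List (RawChoice N × ℚ)
  votes = concatMap copies pairs

  contribution : Fin N → Fin N → WeightedPair N → ℚ
  contribution p q e = toℚ (average (view e) p q) * (weight e * share)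

  positional : Fin N → Fin N → ℚ
  positional p q = ∑ pairs (contribution p q)

  vote : Fin N → Fin N → RawChoice N × ℚ → ℚ
  vote u v (d , r) = toℚ (W d u v) * r

  copies-margin : ∀ e u v → ∑ (copies e) (vote u v) ≡ contribution (position u) (position v) e
  copies-margin e u v = begin
    ∑ (copies e) (vote u v)                 ≡⟨ ∑-++ (copiesBy translation e) (copiesBy reflection e) (vote u v) ⟩
    ∑ (copiesBy translation e) (vote u v) + ∑ (copiesBy reflection e) (vote u v)
                                            ≡⟨ cong₂ _+_ (orbit translation) (orbit reflection) ⟩
    toℚ Oᵗ * w + toℚ Oʳ * w                 ≡⟨ sym (ℚP.*-distribʳ-+ w (toℚ Oᵗ) (toℚ Oʳ)) ⟩
    (toℚ Oᵗ + toℚ Oʳ) * w                   ≡⟨ cong (_* w) (sym (toℚ-+ Oᵗ Oʳ)) ⟩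
    toℚ (average (view e) p q) * w          ∎
    where
    open ≡-Reasoning
    w = weight e * share
    p = position u
    q = position v
    Oᵗ = orbitSum translation (view e) p q
    Oʳ = orbitSum reflection (view e) p q
    orbit : ∀ π → ∑ (copiesBy π e) (vote u v) ≡ toℚ (orbitSum π (view e) p q) * w
    orbit π = begin
      ∑ (copiesBy π e) (vote u v)
        ≡⟨ ∑-map (allFin m) (λ k → copy π e k , w) (vote u v) ⟩
      ∑ (allFin m) (λ k → toℚ (W (copy π e k) u v) * w)
        ≡⟨ ∑-cong (allFin m) (λ k → cong (λ z → toℚ z * w) (W-permute (relabelling π e k) c u v)) ⟩
      ∑ (allFin m) (λ k → toℚ (view e (lift₂ (π k) ⟨$⟩ʳ p) (lift₂ (π k) ⟨$⟩ʳ q)) * w)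
        ≡⟨ ∑-integers m (λ k → view e (lift₂ (π k) ⟨$⟩ʳ p) (lift₂ (π k) ⟨$⟩ʳ q)) w ⟩
      toℚ (orbitSum π (view e) p q) * w ∎

  margin : ∀ u v → weightedW votes u v ≡ positional (position u) (position v)
  margin u v = trans (∑-concatMap pairs copies (vote u v)) (∑-cong pairs (λ e → copies-margin e u v))

  positional-antisym : ∀ p q → positional q p ≡ ℚ.- positional p q
  positional-antisym p q = trans (∑-cong pairs flipped) (∑-neg pairs (contribution p q))
    where
    flipped : ∀ e → contribution q p e ≡ ℚ.- contribution p q e
    flipped e = begin
      toℚ (average (view e) q p) * w        ≡⟨ cong (λ z → toℚ z * w) (average-antisym (view-antisym e) q p) ⟩
      toℚ (- average (view e) p q) * w      ≡⟨ cong (_* w) (toℚ-neg (average (view e) p q)) ⟩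
      ℚ.- toℚ (average (view e) p q) * w    ≡⟨ sym (ℚP.neg-distribˡ-* (toℚ (average (view e) p q)) w) ⟩
      ℚ.- (toℚ (average (view e) p q) * w)  ∎
      where
      open ≡-Reasoning
      w = weight e * share

  positional-zero : ∀ p q → (∀ e → average (view e) p q ≡ + 0) → positional p q ≡ 0ℚ
  positional-zero p q avg≡0 = trans (∑-cong pairs vanishes) (∑-zero pairs)
    where
    vanishes : ∀ e → contribution p q e ≡ 0ℚ
    vanishes e = trans (cong (λ z → toℚ z * (weight e * share)) (avg≡0 e)) (ℚP.*-zeroˡ (weight e * share))

  positional-fixed : positional zero (suc zero) ≡ proj₁ cert
  positional-fixed = trans (∑-congᴾ pairs proper per-pair) matches
    where
    open ℚSolver.+-*-Solver
    per-pair : ∀ e → Proper e → contribution zero (suc zero) e ≡ matchValue c e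
    per-pair e@(ρ , a , b) (_ , a≢b) = begin
      toℚ (average (view e) zero (suc zero)) * (ρ * share)
        ≡⟨ cong (λ z → toℚ z * (ρ * share)) average≡ ⟩
      toℚ (+ m ℤ.* W c a b ℤ.+ + m ℤ.* W c a b) * (ρ * share)
        ≡⟨ cong (_* (ρ * share)) toℚ≡ ⟩
      (M * Wab + M * Wab) * (ρ * share)
        ≡⟨ solve 4 (λ M w ρ s → (M :* w :+ M :* w) :* (ρ :* s) := (ρ :* w) :* ((M :+ M) :* s)) refl M Wab ρ share ⟩
      (ρ * Wab) * ((M + M) * share)
        ≡⟨ cong (λ t → (ρ * Wab) * (t * share)) (sym (toℚ-+ (+ m) (+ m))) ⟩
      (ρ * Wab) * (toℚ (+ m ℤ.+ + m) * share)
        ≡⟨ trans (cong ((ρ * Wab) *_) share-total) (ℚP.*-identityʳ (ρ * Wab)) ⟩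
      ρ * Wab ∎
      where
      open ≡-Reasoning
      M = toℚ (+ m)
      Wab = toℚ (W c a b)
      average≡ : average (view e) zero (suc zero) ≡ + m ℤ.* W c a b ℤ.+ + m ℤ.* W c a b
      average≡ = trans (average-fixed (view e)) (cong (λ t → + m ℤ.* t ℤ.+ + m ℤ.* t) (relabelled-fixed a b a≢b))
      toℚ≡ : toℚ (+ m ℤ.* W c a b ℤ.+ + m ℤ.* W c a b) ≡ M * Wab + M * Wab
      toℚ≡ = trans (toℚ-+ (+ m ℤ.* W c a b) (+ m ℤ.* W c a b)) (cong₂ _+_ (toℚ-* (+ m) (W c a b)) (toℚ-* (+ m) (W c a b)))

  -- From a fixed point to a moving point the votes cancel once the row
  -- sums balance, which the certificate guarantees.
  positional-row : ∀ p r → ∑ pairs (λ e → weight e * toℚ (rowSum (view e) (outer p))) ≡ 0ℚ →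
                   positional (outer p) (inner r) ≡ 0ℚ
  positional-row p r balanced = begin
    positional (outer p) (inner r)                        ≡⟨ ∑-cong pairs per-pair ⟩
    ∑ pairs (λ e → (share + share) * (weight e * row e))  ≡⟨ ∑-*ˡ pairs (share + share) (λ e → weight e * row e) ⟩
    (share + share) * ∑ pairs (λ e → weight e * row e)    ≡⟨ cong ((share + share) *_) balanced ⟩
    (share + share) * 0ℚ                                  ≡⟨ ℚP.*-zeroʳ (share + share) ⟩
    0ℚ                                                    ∎
    where
    open ≡-Reasoning
    open ℚSolver.+-*-Solver
    row : WeightedPair N → ℚ
    row e = toℚ (rowSum (view e) (outer p))
    per-pair : ∀ e → contribution (outer p) (inner r) e ≡ (share + share) * (weight e * row e)
    per-pair e = begin
      toℚ (average (view e) (outer p) (inner r)) * (weight e * share)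
        ≡⟨ cong (λ z → toℚ z * (weight e * share)) (average-row (view e) p r) ⟩
      toℚ (rowSum (view e) (outer p) ℤ.+ rowSum (view e) (outer p)) * (weight e * share)
        ≡⟨ cong (_* (weight e * share)) (toℚ-+ (rowSum (view e) (outer p)) (rowSum (view e) (outer p))) ⟩
      (row e + row e) * (weight e * share)
        ≡⟨ solve 3 (λ R ρ s → (R :+ R) :* (ρ :* s) := (s :+ s) :* (ρ :* R)) refl (row e) (weight e) share ⟩
      (share + share) * (weight e * row e) ∎

  balanced-first : ∑ pairs (λ e → weight e * toℚ (rowSum (view e) zero)) ≡ 0ℚ
  balanced-first = trans (∑-congᴾ pairs proper row≡) firsts
    where
    row≡ : ∀ e → Proper e → weight e * toℚ (rowSum (view e) zero) ≡ firstCoord c e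
    row≡ (ρ , a , b) (_ , a≢b) = cong (λ z → ρ * toℚ z) (rowSum-first a b a≢b)

  balanced-second : ∑ pairs (λ e → weight e * toℚ (rowSum (view e) (suc zero))) ≡ 0ℚ
  balanced-second = trans (∑-congᴾ pairs proper row≡) seconds
    where
    row≡ : ∀ e → Proper e → weight e * toℚ (rowSum (view e) (suc zero)) ≡ secondCoord c e
    row≡ (ρ , a , b) (_ , a≢b) = cong (λ z → ρ * toℚ z) (rowSum-second a b a≢b)

  positional-diagonal : ∀ p → positional p p ≡ 0ℚ
  positional-diagonal p = positional-zero p p (λ e → antisym-diag (average-antisym (view-antisym e)) p)

  positional-off : ∀ p q → ¬ SamePair zero (suc zero) p q → positional p q ≡ 0ℚ
  positional-off zero             zero             _ = positional-diagonal zero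
  positional-off zero             (suc zero)       ¬01 = ⊥-elim (¬01 (inj₁ (refl , refl)))
  positional-off zero             (suc (suc r))    _ = positional-row zero r balanced-first
  positional-off (suc zero)       zero             ¬01 = ⊥-elim (¬01 (inj₂ (refl , refl)))
  positional-off (suc zero)       (suc zero)       _ = positional-diagonal (suc zero)
  positional-off (suc zero)       (suc (suc r))    _ = positional-row (suc zero) r balanced-second
  positional-off (suc (suc r))    zero             _ =
    trans (positional-antisym zero (inner r)) (cong ℚ.-_ (positional-row zero r balanced-first))
  positional-off (suc (suc r))    (suc zero)       _ =
    trans (positional-antisym (suc zero) (inner r)) (cong ℚ.-_ (positional-row (suc zero) r balanced-second))
  positional-off (suc (suc i))    (suc (suc j))    _ =
    positional-zero (inner i) (inner j) (λ e → average-inner (view-antisym e) i j)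

  margin-off : ∀ u v → ¬ SamePair x y u v → weightedW votes u v ≡ 0ℚ
  margin-off u v ¬xy = trans (margin u v) (positional-off (position u) (position v) (¬xy ∘ back))
    where
    back : SamePair zero (suc zero) (position u) (position v) → SamePair x y u v
    at-0 : ∀ {u} → position u ≡ zero → u ≡ x
    at-0 u↦0 = trans (from-position u↦0) (moveTo-0 x y x≢y)
    at-1 : ∀ {u} → position u ≡ suc zero → u ≡ y
    at-1 u↦1 = trans (from-position u↦1) (moveTo-1 x y)
    back (inj₁ (u↦0 , v↦1)) = inj₁ (at-0 u↦0 , at-1 v↦1)
    back (inj₂ (u↦1 , v↦0)) = inj₂ (at-1 u↦1 , at-0 v↦0)

  margin-xy : weightedW votes x y ≡ proj₁ cert
  margin-xy = trans (margin x y) (trans (cong₂ positional position-x position-y) positional-fixed)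

  margin-antisym : weightedW votes y x ≡ ℚ.- weightedW votes x y
  margin-antisym = trans (margin y x) (trans (positional-antisym (position x) (position y)) (cong ℚ.-_ (sym (margin x y))))

  votes-total : ∑ votes proj₂ ≡ 1ℚ
  votes-total = trans (∑-concatMap pairs copies proj₂) (trans (∑-cong pairs per-pair) total)
    where
    open ℚSolver.+-*-Solver
    per-pair : ∀ e → ∑ (copies e) proj₂ ≡ weight e
    per-pair e = begin
      ∑ (copies e) proj₂                   ≡⟨ ∑-++ (copiesBy translation e) (copiesBy reflection e) proj₂ ⟩
      ∑ (copiesBy translation e) proj₂ + ∑ (copiesBy reflection e) proj₂
                                           ≡⟨ cong₂ _+_ (each translation) (each reflection) ⟩
      M * w + M * w
        ≡⟨ solve 3 (λ M ρ s → M :* (ρ :* s) :+ M :* (ρ :* s) := ρ :* ((M :+ M) :* s)) refl M (weight e) share ⟩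
      weight e * ((M + M) * share)         ≡⟨ cong (λ t → weight e * (t * share)) (sym (toℚ-+ (+ m) (+ m))) ⟩
      weight e * (toℚ (+ m ℤ.+ + m) * share) ≡⟨ trans (cong (weight e *_) share-total) (ℚP.*-identityʳ (weight e)) ⟩
      weight e                             ∎
      where
      open ≡-Reasoning
      w = weight e * share
      M = toℚ (+ m)
      each : ∀ π → ∑ (copiesBy π e) proj₂ ≡ M * w
      each π = trans (∑-map (allFin m) (λ k → copy π e k , w) proj₂) (∑-const m w)

  votes-valid : ListAll.All (λ v → 𝒞 (proj₁ v) × 0ℚ ≤ proj₂ v) votes
  votes-valid = ListAllP.concat⁺ (ListAllP.map⁺ (ListAll.map valid proper))
    where
    valid : ∀ {e} → Proper e → ListAll.All (λ v → 𝒞 (proj₁ v) × 0ℚ ≤ proj₂ v) (copies e)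
    valid {e} (ρ≥0 , _) = ListAllP.++⁺ (each translation) (each reflection)
      where
      each : ∀ π → ListAll.All (λ v → 𝒞 (proj₁ v) × 0ℚ ≤ proj₂ v) (copiesBy π e)
      each π = all-map-allFin (λ k → copy π e k , weight e * share)
                              (λ k → symm (relabelling π e k) c c∈𝒞 , *-nonNeg ρ≥0 share≥0)

  votes-weighted : All (λ v → 𝒞 (proj₁ v) × (0ℚ ≤ proj₂ v) × (proj₂ v ≤ 1ℚ)) votes
  votes-weighted = toDefsAll bounded (ListAll.zip (votes-valid , weight≤total proj₂ votes (ListAll.map proj₂ votes-valid)))
    where
    bounded : ∀ {v} → (𝒞 (proj₁ v) × 0ℚ ≤ proj₂ v) × proj₂ v ≤ ∑ votes proj₂ →
              𝒞 (proj₁ v) × (0ℚ ≤ proj₂ v) × (proj₂ v ≤ 1ℚ)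
    bounded ((c∈ , w≥0) , w≤total) = c∈ , w≥0 , subst (_ ≤_) votes-total w≤total

  majority : Σ (RawChoice N) (λ d → InMajCl 𝒞 d × DomIsPair d x y)
  majority = onlyPair x y
           , ( onlyPair-choice x≢y , votes , votes-weighted , votes-total
             , onlyPair-majority x≢y (weightedW votes) xy>0 margin-antisym margin-off )
           , onlyPair-domain x≢y
    where
    xy>0 : 0ℚ < weightedW votes x y
    xy>0 = subst (0ℚ <_) (sym margin-xy) (proj₁ (proj₂ cert))

mainTheorem12 : (n : ℕ) → 3 ℕ.≤ n → (𝒞 : RawChoice n → Set) →
    (∀ c → 𝒞 c → IsChoiceFn c) → Symmetric 𝒞 →
    Σ (RawChoice n) (λ c → 𝒞 c × ValenceImbalanced c) →
    (x y : Fin n) → x ≢ y →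
    Σ (RawChoice n) (λ d → InMajCl 𝒞 d × DomIsPair d x y)
mainTheorem12 (suc zero)       (s≤s ())       _ _ _ _ _ _ _
mainTheorem12 (suc (suc zero)) (s≤s (s≤s ())) _ _ _ _ _ _ _
mainTheorem12 (suc (suc (suc m′))) _ 𝒞 choice symm (c , c∈𝒞 , imbalanced) x y x≢y =
  Construction.majority m′ 𝒞 symm c∈𝒞 isC x≢y (imbalanced⇒certificate isC imbalanced)
  where
  isC : IsChoiceFn c
  isC = choice c c∈𝒞
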